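{- Let $T$ and $T'$ be DFS trees of size $n$. Assume that for every $x_i\in\{x_2,\dots,x_n\}$, if $T_{x_i}=T'_{x_i}$ then $x_i$ has the same parent in $T$ and in $T'$. Then $T=T'$.
   Context: $B_n$ is the set of bracketings of $x_1x_2\cdots x_n$ (binary terms with $x_1,\dots,x_n$ each occurring once, in this order). For $t\in B_n$, $G(t)$ is the rooted tree on $\{x_1,\dots,x_n\}$ defined recursively: $G(x_i)$ is the single vertex $x_i$; for $t=t_1t_2$, $G(t)$ is $G(t_1)\cup G(t_2)$ plus an edge from the root of $G(t_1)$ to the root of $G(t_2)$, rooted at the root of $G(t_1)$. A DFS tree of size $n$ is $G(t)$ for some $t\in B_n$; its root is $x_1$. $T_x$ denotes the subtree induced by $x$ and all its descendants, rooted at $x$; $T_x=T'_x$ means equality as rooted trees (same vertices and edges). -}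

module Defs where

open import Data.Nat using (ℕ; zero; suc; _+_)
open import Data.Fin using (Fin; zero; suc; toℕ; _↑ˡ_; _↑ʳ_)
open import Data.Product using (_×_)
open import Function.Bundles using (_⇔_)

-- Vertices x_1, ..., x_n are represented by Fin n (x_i ↦ i - 1); x_1 is 'zero'.

-- Bracketings of x_1 ⋯ x_n (binary terms with the variables in order).
-- The index is the number of variables.
data Br : ℕ → Set where
  leaf : Br 1
  node : ∀ {m k} → Br (suc m) → Br (suc k) → Br (suc m + suc k)

-- Edges (parent , child) of the rooted tree G(t).
-- For t = t₁ t₂ with t₁ of size m, the variables of t₂ are shifted by m.
-- The root of G(t) is always its first variable ('zero').
data Edge : ∀ {n} → Br n → Fin n → Fin n → Set where
  left  : ∀ {m k} {t₁ : Br (suc m)} {t₂ : Br (suc k)} {p c : Fin (suc m)} →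
          Edge t₁ p c → Edge (node t₁ t₂) (p ↑ˡ suc k) (c ↑ˡ suc k)
  right : ∀ {m k} {t₁ : Br (suc m)} {t₂ : Br (suc k)} {p c : Fin (suc k)} →
          Edge t₂ p c → Edge (node t₁ t₂) ((suc m ↑ʳ p)) ((suc m ↑ʳ c))
  join  : ∀ {m k} {t₁ : Br (suc m)} {t₂ : Br (suc k)} →
          Edge (node t₁ t₂) zero ((suc m ↑ʳ zero))

data Desc {n} (t : Br n) : Fin n → Fin n → Set where
  here : ∀ {x} → Desc t x x
  step : ∀ {x y z} → Edge t x y → Desc t y z → Desc t x z

-- Equality of G(t) and G(t') as rooted trees (both rooted at x_1, same vertex set):
-- same edge set.
TreeEq : ∀ {n} → Br n → Br n → Set
TreeEq {n} t t' = ∀ (p c : Fin n) → Edge t p c ⇔ Edge t' p c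

SubtreeEq : ∀ {n} → Br n → Br n → Fin n → Set
SubtreeEq {n} t t' x =
  (∀ (y : Fin n) → Desc t x y ⇔ Desc t' x y) ×
  (∀ (p c : Fin n) → (Desc t x p × Desc t x c × Edge t p c)
                   ⇔ (Desc t' x p × Desc t' x c × Edge t' p c))

SameParent : ∀ {n} → Br n → Br n → Fin n → Set
SameParent {n} t t' x = ∀ (p : Fin n) → Edge t p x ⇔ Edge t' p x

module Submission where

open import Defs
open import Data.Nat using (ℕ; suc; z≤n; s≤s)
import Data.Nat as ℕ
open import Data.Nat.Properties using (≤-refl; ≤-trans; <⇒≤; <-trans; ≤-<-trans; +-monoʳ-<; n≮0)
open import Data.Fin using (Fin; toℕ; _<_; _≤_; _>_; _↑ˡ_; _↑ʳ_)
open import Data.Fin.Properties using (toℕ-↑ˡ; toℕ-↑ʳ)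
open import Data.Fin.Induction using (>-wellFounded)
open import Data.Product using (_×_; _,_)
open import Function.Bundles using (mk⇔; Equivalence)
import Function.Properties.Equivalence as ⇔
open import Induction.WellFounded using (Acc; acc)
open import Data.Empty using (⊥-elim)
open import Relation.Nullary using (¬_; yes; no)
open import Relation.Binary.PropositionalEquality using (_≡_; _≢_; subst)

-- Vertices of G(t) are numbered in depth-first order, so every edge goes from a
-- smaller to a larger vertex.  Hence the parent of x is fixed as soon as all
-- vertices above x have their parents fixed: their subtrees then agree, and the
-- hypothesis applies.  Downward induction over Fin n settles every vertex but the
-- root, which has no parent in either tree.

Edge-< : ∀ {n} {t : Br n} {p c} → Edge t p c → p < c
Edge-< (left {k = k} {p = p} {c = c} e)
  rewrite toℕ-↑ˡ p (suc k) | toℕ-↑ˡ c (suc k) = Edge-< e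
Edge-< (right {m = m} {p = p} {c = c} e)
  rewrite toℕ-↑ʳ (suc m) p | toℕ-↑ʳ (suc m) c = +-monoʳ-< (suc m) (Edge-< e)
Edge-< join = s≤s z≤n

Desc-≤ : ∀ {n} {t : Br n} {x y} → Desc t x y → x ≤ y
Desc-≤ here       = ≤-refl
Desc-≤ (step e d) = ≤-trans (<⇒≤ (Edge-< e)) (Desc-≤ d)

root-parentless : ∀ {n} {t : Br n} {p x} → toℕ x ≡ 0 → ¬ Edge t p x
root-parentless x≡0 e = n≮0 (subst (_ ℕ.<_) x≡0 (Edge-< e))

SameParent-sym : ∀ {n} {t t' : Br n} {x} → SameParent t t' x → SameParent t' t x
SameParent-sym sp p = ⇔.sym (sp p)

SameParentAbove : ∀ {n} → Br n → Br n → Fin n → Set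
SameParentAbove t t' x = ∀ y → x < y → SameParent t t' y

SameParentAbove-sym : ∀ {n} {t t' : Br n} {x} →
                      SameParentAbove t t' x → SameParentAbove t' t x
SameParentAbove-sym above y x<y = SameParent-sym (above y x<y)

Desc-transport : ∀ {n} {t t' : Br n} {x z} →
                 SameParentAbove t t' x → Desc t x z → Desc t' x z
Desc-transport above here = here
Desc-transport {x = x} above (step {y = y} e d) =
  step (Equivalence.to (above y (Edge-< e) x) e)
       (Desc-transport (λ w y<w → above w (<-trans (Edge-< e) y<w)) d)

InducedEdge-transport : ∀ {n} {t t' : Br n} {x p c} → SameParentAbove t t' x →
                        Desc t x p × Desc t x c × Edge t p c →
                        Desc t' x p × Desc t' x c × Edge t' p c
InducedEdge-transport {c = c} above (dp , dc , e) =
  Desc-transport above dp , Desc-transport above dc ,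
  Equivalence.to (above c (≤-<-trans (Desc-≤ dp) (Edge-< e)) _) e

SameParentAbove⇒SubtreeEq : ∀ {n} {t t' : Br n} {x} →
                            SameParentAbove t t' x → SubtreeEq t t' x
SameParentAbove⇒SubtreeEq above =
  (λ _ → mk⇔ (Desc-transport above) (Desc-transport (SameParentAbove-sym above)))
  , λ _ _ → mk⇔ (InducedEdge-transport above)
                (InducedEdge-transport (SameParentAbove-sym above))

SameParent-everywhere : ∀ {n} {t t' : Br n} →
  (∀ (x : Fin n) → toℕ x ≢ 0 → SubtreeEq t t' x → SameParent t t' x) →
  ∀ x → SameParent t t' x
SameParent-everywhere {t = t} {t'} H x = go x (>-wellFounded x)
  where
  go : ∀ x → Acc _>_ x → SameParent t t' x
  go x (acc rec) with toℕ x ℕ.≟ 0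
  ... | yes x≡0 = λ _ → mk⇔ (λ e → ⊥-elim (root-parentless x≡0 e))
                            (λ e → ⊥-elim (root-parentless x≡0 e))
  ... | no x≢0  = H x x≢0 (SameParentAbove⇒SubtreeEq λ y x<y → go y (rec x<y))

lemma6p13 : (n : ℕ) (t t' : Br n) →
    (∀ (x : Fin n) → toℕ x ≢ 0 → SubtreeEq t t' x → SameParent t t' x) →
    TreeEq t t'
lemma6p13 n t t' H p c = SameParent-everywhere H c p
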